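{- Let $\Gamma_1=\mathbb Z_{2^{n_1}}\oplus\cdots\oplus\mathbb Z_{2^{n_r}}$ and $\Gamma_2=\mathbb Z_{p_1^{m_1}}\oplus\cdots\oplus\mathbb Z_{p_s^{m_s}}$ with all primes $p_i>2$, and $\Gamma=\Gamma_1\oplus\Gamma_2$, with $\mathbf m_\Gamma=(2^{n_1},\dots,2^{n_r},p_1^{m_1},\dots,p_s^{m_s})$. Let $d_{r+1},\dots,d_{r+s}$ be fixed divisors of $p_1^{m_1},\dots,p_s^{m_s}$ respectively. Let $\mathbf D$ be a set of divisor tuples of $\mathbf m_\Gamma$ with $\mathbf m_\Gamma\notin\mathbf D$, such that the last $s$ components of every $\mathbf d\in\mathbf D$ are $d_{r+1},\dots,d_{r+s}$. Then there exists a cubelike graph $X(\mathbf C)$ such that $$Cay(\Gamma,S_\Gamma(\mathbf D))\cong X(\mathbf C)\times Cay\big(\Gamma_2,S_{\Gamma_2}(\{(d_{r+1},\dots,d_{r+s})\})\big).$$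
   Context: For a finite abelian group $\Gamma$ and symmetric $S\subseteq\Gamma$, $Cay(\Gamma,S)$ has vertex set $\Gamma$ with $a\sim b$ iff $a-b\in S$; if $0\in S$ every vertex carries a loop (contributing $1$ to the adjacency matrix). Gcd-sets: for $\Gamma=\mathbb Z_{m_1}\oplus\cdots\oplus\mathbb Z_{m_k}$ with $\mathbf m=(m_1,\dots,m_k)$, represent $x_i\in\mathbb Z_{m_i}$ by an integer in $\{0,\dots,m_i-1\}$, with convention $\gcd(0,n)=n$; a divisor tuple of $\mathbf m$ is $\mathbf d=(d_1,\dots,d_k)$ with $1\le d_i\mid m_i$; $S_\Gamma(\mathbf d)=\{\mathbf x\in\Gamma:\gcd(x_i,m_i)=d_i\ \forall i\}$ and $S_\Gamma(\mathbf D)=\bigcup_{\mathbf d\in\mathbf D}S_\Gamma(\mathbf d)$. A cubelike graph $X(\mathbf C)$ is $Cay(\mathbb Z_2^N,\mathbf C)$ for some $N$ and $\mathbf C\subseteq\mathbb Z_2^N$. The Kronecker product $G_1\times G_2$ has vertex set $V(G_1)\times V(G_2)$ with $(u_1,u_2)\sim(v_1,v_2)$ iff $u_1\sim v_1$ and $u_2\sim v_2$ (adjacency matrix $A_1\otimes A_2$). -}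

module Defs where

open import Data.Nat using (ℕ; zero; suc; _+_; _∸_; _^_; _%_; _≤_)
open import Data.Nat.GCD using (gcd)
open import Data.Nat.Divisibility using (_∣_)
open import Data.Nat.Primality using (Prime)
open import Data.Fin using (Fin; toℕ)
open import Data.Bool using (Bool; _xor_)
open import Data.Unit using (⊤; tt)
open import Data.Product using (_×_; _,_; Σ; ∃)
open import Data.List using (List; []; _∷_; map; _++_)
open import Data.Vec using (Vec; zipWith)
open import Data.List.Membership.Propositional using (_∈_)
open import Data.List.Relation.Binary.Pointwise using (Pointwise)
open import Function.Bundles using (_↔_; _⇔_; Inverse)
open import Relation.Binary.PropositionalEquality using (_≡_)

-- Elements of Z_{m_1} ⊕ ... ⊕ Z_{m_k}, for the list of moduli ms = (m_1,…,m_k).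
-- Each component x_i ∈ Z_{m_i} is represented by a Fin m_i, i.e. an integer in {0,…,m_i-1}.
Elem : List ℕ → Set
Elem []       = ⊤
Elem (m ∷ ms) = Fin m × Elem ms

subMod : ∀ {m} → Fin m → Fin m → ℕ
subMod {suc m} a b = (toℕ a + (suc m ∸ toℕ b)) % suc m

-- the gcd-tuple of a - b:  (gcd((a-b)_i , m_i))_i ; stdlib has gcd 0 n = n (the convention).
gcdTupleDiff : (ms : List ℕ) → Elem ms → Elem ms → List ℕ
gcdTupleDiff []       _        _        = []
gcdTupleDiff (m ∷ ms) (a , as) (b , bs) = gcd (subMod a b) m ∷ gcdTupleDiff ms as bs

-- Adjacency of Cay(Γ, S_Γ(D)) for Γ = ⊕ Z_{m_i}:  a ~ b  iff  a - b ∈ S_Γ(D),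
-- i.e. iff the gcd-tuple of a - b belongs to D (a finite set of divisor tuples, given as a list).
CayGcdAdj : (ms : List ℕ) → List (List ℕ) → Elem ms → Elem ms → Set
CayGcdAdj ms D a b = gcdTupleDiff ms a b ∈ D

IsDivisorTuple : List ℕ → List ℕ → Set
IsDivisorTuple d m = Pointwise _∣_ d m

-- Cubelike graph X(C) = Cay(Z_2^N, C), C ⊆ Z_2^N given as a list of vectors;
-- a ~ b iff a - b = a xor b ∈ C.
CubeAdj : ∀ {N} → List (Vec Bool N) → Vec Bool N → Vec Bool N → Set
CubeAdj C a b = zipWith _xor_ a b ∈ C

KronAdj : ∀ {V W : Set} → (V → V → Set) → (W → W → Set) → (V × W) → (V × W) → Set
KronAdj A B (u₁ , u₂) (v₁ , v₂) = A u₁ v₁ × B u₂ v₂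

GraphIso : ∀ {V W : Set} → (V → V → Set) → (W → W → Set) → Set
GraphIso {V} {W} A B =
  Σ (V ↔ W) λ f → ∀ u v → A u v ⇔ B (Inverse.to f u) (Inverse.to f v)

oddModuli : ∀ {s} → Vec ℕ s → Vec ℕ s → List ℕ
oddModuli ps es = Data.Vec.toList (zipWith _^_ ps es)

-- Write each x ∈ Z_{2^n} in binary (least significant bit first).  Then
-- gcd(a − b, 2^n) = 2^i where i is the lowest bit in which a and b differ (2^n if a = b), so
-- the gcd-tuple of a − b on Γ₁ is a function `profile` of the bitwise xor of the binary codes:
-- Γ₁ ≅ Z₂^N with N = Σ n_i, and the gcd-tuple on Γ₁ is read off from the difference in Z₂^N.
-- Since every tuple in D has the same tail dT, a ∼ b in Cay(Γ, S(D)) iff the Γ₂-parts differ by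
-- an element of S_{Γ₂}({dT}) and the Z₂^N-codes differ by an element of
-- C = {c ∈ Z₂^N : profile(c) ++ dT ∈ D}; this is exactly adjacency in X(C) × Cay(Γ₂, S({dT})).
module Submission where

open import Defs
open import Data.Nat using (ℕ; zero; suc; _+_; _*_; _^_; _∸_; _%_; ⌊_/2⌋; _<_; _≤_; z≤n; s≤s; NonZero)
open import Data.Nat.Properties
open import Data.Nat.Divisibility
open import Data.Nat.GCD
open import Data.Nat.Coprimality using (Coprime; coprime-factors; coprime⇒gcd≡1)
open import Data.Nat.Primality using (Prime; irreducible[2])
open import Data.Bool using (Bool; true; false; _xor_)
open import Data.Empty using (⊥-elim)
open import Data.Fin using (Fin; toℕ; fromℕ<)
open import Data.Fin.Properties using (toℕ<n; toℕ-fromℕ<; toℕ-injective)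
open import Data.List using (List; []; _∷_; map; drop; length; _++_; filter; allFin)
open import Data.List.Properties using (length-map; ≡-dec)
open import Data.List.Membership.Propositional using (_∈_; _∉_)
open import Data.List.Membership.Propositional.Properties
  using (∈-filter⁺; ∈-filter⁻; ∈-map⁺; ∈-allFin)
import Data.List.Membership.DecPropositional as DecMembership
open import Data.List.Relation.Unary.Any using (here)
open import Data.Product using (Σ; _×_; _,_; proj₁; proj₂)
open import Data.Product.Properties using (×-≡,≡→≡)
open import Data.Product.Function.NonDependent.Propositional using (_×-↔_)
open import Data.Sum using (inj₁; inj₂)
open import Data.Unit using (tt)
open import Data.Vec using (Vec; []; _∷_; zipWith; take; toList)
  renaming (_++_ to _++ᵛ_; drop to dropᵛ)
open import Data.Vec.Properties using (take++drop≡id; ++-injective; zipWith-++; length-toList)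
open import Data.Vec.Relation.Unary.All using () renaming (All to VAll)
open import Function using (_∘_)
open import Function.Bundles using (_↔_; _⇔_; mk↔ₛ′; mk⇔; Inverse; Equivalence)
open import Function.Properties.Inverse using (↔-refl; ↔-trans)
open import Relation.Binary.PropositionalEquality
  using (_≡_; refl; sym; trans; cong; cong₂; subst; module ≡-Reasoning)
open import Relation.Nullary using (¬_; contradiction)
open import Relation.Unary using (Decidable)

bit : Bool → ℕ
bit false = 0
bit true  = 1

bit<2 : ∀ b → bit b < 2
bit<2 false = s≤s z≤n
bit<2 true  = s≤s (s≤s z≤n)

val : ∀ {n} → Vec Bool n → ℕ
val []      = 0
val (b ∷ v) = bit b + 2 * val v

val< : ∀ {n} (v : Vec Bool n) → val v < 2 ^ n
val< []      = s≤s z≤n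
val< {suc n} (b ∷ v) = begin-strict
  bit b + 2 * val v    <⟨ +-monoˡ-< (2 * val v) (bit<2 b) ⟩
  2 + 2 * val v        ≡⟨ sym (*-suc 2 (val v)) ⟩
  2 * suc (val v)      ≤⟨ *-monoʳ-≤ 2 (val< v) ⟩
  2 * 2 ^ n            ∎
  where open ≤-Reasoning

lsb : ℕ → Bool
lsb zero          = false
lsb (suc zero)    = true
lsb (suc (suc x)) = lsb x

bit-half : ∀ x → bit (lsb x) + 2 * ⌊ x /2⌋ ≡ x
bit-half zero          = refl
bit-half (suc zero)    = refl
bit-half (suc (suc x)) = begin
  bit (lsb x) + 2 * suc ⌊ x /2⌋          ≡⟨ cong (bit (lsb x) +_) (*-suc 2 ⌊ x /2⌋) ⟩
  bit (lsb x) + (2 + 2 * ⌊ x /2⌋)        ≡⟨ +-suc (bit (lsb x)) _ ⟩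
  suc (bit (lsb x) + suc (2 * ⌊ x /2⌋))  ≡⟨ cong suc (+-suc (bit (lsb x)) _) ⟩
  suc (suc (bit (lsb x) + 2 * ⌊ x /2⌋))  ≡⟨ cong (suc ∘ suc) (bit-half x) ⟩
  suc (suc x)                            ∎
  where open ≡-Reasoning

bit-unique : ∀ b b′ q q′ → bit b + 2 * q ≡ bit b′ + 2 * q′ → b ≡ b′ × q ≡ q′
bit-unique false false q q′ e = refl , *-cancelˡ-≡ q q′ 2 e
bit-unique true  true  q q′ e = refl , *-cancelˡ-≡ q q′ 2 (suc-injective e)
bit-unique false true  q q′ e = ⊥-elim (even≢odd q q′ e)
bit-unique true  false q q′ e = ⊥-elim (even≢odd q′ q (sym e))

bits : (n : ℕ) → ℕ → Vec Bool n
bits zero    x = []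
bits (suc n) x = lsb x ∷ bits n ⌊ x /2⌋

val-bits : ∀ n x → x < 2 ^ n → val (bits n x) ≡ x
val-bits zero    x x<1 = sym (n<1⇒n≡0 x<1)
val-bits (suc n) x x<  = trans (cong (λ h → bit (lsb x) + 2 * h) (val-bits n ⌊ x /2⌋ half<))
                               (bit-half x)
  where
  half< : ⌊ x /2⌋ < 2 ^ n
  half< = *-cancelˡ-< 2 _ _ (≤-<-trans 2h≤x x<)
    where
    2h≤x : 2 * ⌊ x /2⌋ ≤ x
    2h≤x = subst (2 * ⌊ x /2⌋ ≤_) (bit-half x) (m≤n+m (2 * ⌊ x /2⌋) (bit (lsb x)))

bits-val : ∀ {n} (v : Vec Bool n) → bits n (val v) ≡ v
bits-val []      = refl
bits-val (b ∷ v) with bit-unique (lsb y) b ⌊ y /2⌋ (val v) (bit-half y)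
  where
  y : ℕ
  y = bit b + 2 * val v
... | lsb≡b , half≡val = cong₂ _∷_ lsb≡b (trans (cong (bits _) half≡val) (bits-val v))

toBits : ∀ n → Fin (2 ^ n) → Vec Bool n
toBits n a = bits n (toℕ a)

fromBits : ∀ {n} → Vec Bool n → Fin (2 ^ n)
fromBits v = fromℕ< (val< v)

val-toBits : ∀ n (a : Fin (2 ^ n)) → val (toBits n a) ≡ toℕ a
val-toBits n a = val-bits n (toℕ a) (toℕ<n a)

toBits-fromBits : ∀ {n} (v : Vec Bool n) → toBits n (fromBits v) ≡ v
toBits-fromBits v = trans (cong (bits _) (toℕ-fromℕ< (val< v))) (bits-val v)

binary : ∀ n → Fin (2 ^ n) ↔ Vec Bool n
binary n = mk↔ₛ′ (toBits n) fromBits toBits-fromBits fromBits-toBits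
  where
  fromBits-toBits : ∀ a → fromBits (toBits n a) ≡ a
  fromBits-toBits a = toℕ-injective (trans (toℕ-fromℕ< (val< (toBits n a))) (val-toBits n a))

even-summand : ∀ {t y z} → t + 2 * y ≡ 2 * z → Σ ℕ λ t′ → t ≡ 2 * t′ × t′ + y ≡ z
even-summand {t} {y} {z} e with ∣m+n∣m⇒∣n 2∣2y+t (m∣m*n y)
  where
  2∣2y+t : 2 ∣ 2 * y + t
  2∣2y+t = subst (2 ∣_) (sym (trans (+-comm (2 * y) t) e)) (m∣m*n z)
... | divides t′ t≡t′*2 = t′ , t≡2t′ , *-cancelˡ-≡ (t′ + y) z 2 (begin
  2 * (t′ + y)     ≡⟨ *-distribˡ-+ 2 t′ y ⟩
  2 * t′ + 2 * y   ≡⟨ cong (_+ 2 * y) (sym t≡2t′) ⟩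
  t + 2 * y        ≡⟨ e ⟩
  2 * z            ∎)
  where
  open ≡-Reasoning
  t≡2t′ : t ≡ 2 * t′
  t≡2t′ = trans t≡t′*2 (*-comm t′ 2)

odd-summand : ∀ {t y z} → t + 2 * y ≡ suc (2 * z) → ¬ 2 ∣ t
odd-summand {t} {y} {z} e (divides q t≡q*2) = even≢odd (q + y) z (begin
  2 * (q + y)    ≡⟨ *-distribˡ-+ 2 q y ⟩
  2 * q + 2 * y  ≡⟨ cong (_+ 2 * y) (sym (trans t≡q*2 (*-comm q 2))) ⟩
  t + 2 * y      ≡⟨ e ⟩
  suc (2 * z)    ∎)
  where open ≡-Reasoning

pred-even-odd : ∀ {t u} → suc t ≡ 2 * u → ¬ 2 ∣ t
pred-even-odd {t} {u} e (divides q t≡q*2) =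
  even≢odd u q (trans (sym e) (cong suc (trans t≡q*2 (*-comm q 2))))

odd-coprime-2 : ∀ {t} → ¬ 2 ∣ t → Coprime 2 t
odd-coprime-2 ¬2∣t (d∣2 , d∣t) with irreducible[2] d∣2
... | inj₁ d≡1 = d≡1
... | inj₂ refl = contradiction d∣t ¬2∣t

odd-gcd-2pow : ∀ {t} → ¬ 2 ∣ t → ∀ k → gcd t (2 ^ k) ≡ 1
odd-gcd-2pow {t} ¬2∣t k = coprime⇒gcd≡1 (coprime k)
  where
  coprime : ∀ k → Coprime t (2 ^ k)
  coprime zero    (_ , d∣1)      = ∣1⇒≡1 d∣1
  coprime (suc k) (d∣t , d∣2·2^k) =
    coprime k (d∣t , coprime-factors (odd-coprime-2 ¬2∣t) (d∣2·2^k , ∣-trans d∣t (m∣m*n (2 ^ k))))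

lowBit : ∀ {n} → Vec Bool n → ℕ
lowBit []          = 1
lowBit (true  ∷ c) = 1
lowBit (false ∷ c) = 2 * lowBit c

gcd-halve : ∀ {t y z} k → t + 2 * y ≡ 2 * z + 2 * k →
            Σ ℕ λ t′ → t′ + y ≡ z + k × gcd t (2 * k) ≡ 2 * gcd t′ k
gcd-halve {t} {y} {z} k e with even-summand {t} {y} {z + k} (trans e (sym (*-distribˡ-+ 2 z k)))
... | t′ , refl , e′ = t′ , e′ , sym (c*gcd[m,n]≡gcd[cm,cn] 2 t′ k)

-- If t ≡ val a − val b (mod 2^n), then gcd(t, 2^n) = 2^(lowest bit where a and b differ).
gcd-lowBit : ∀ {n} (a b : Vec Bool n) t → t + val b ≡ val a + 2 ^ n →
             gcd t (2 ^ n) ≡ lowBit (zipWith _xor_ a b)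
gcd-lowBit [] [] t _ = gcd-zeroʳ t
-- Equal lowest digits: halve and recurse.
gcd-lowBit {suc n} (false ∷ a) (false ∷ b) t e with gcd-halve {t} (2 ^ n) e
... | t′ , e′ , g = trans g (cong (2 *_) (gcd-lowBit a b t′ e′))
gcd-lowBit {suc n} (true ∷ a) (true ∷ b) t e
  with gcd-halve {t} (2 ^ n) (suc-injective (trans (sym (+-suc t _)) e))
... | t′ , e′ , g = trans g (cong (2 *_) (gcd-lowBit a b t′ e′))
-- Different lowest digits: t is odd, so the gcd is 1.
gcd-lowBit {suc n} (true ∷ a) (false ∷ b) t e = odd-gcd-2pow {t} (odd-summand {t} {val b} {val a + 2 ^ n} e′) (suc n)
  where
  e′ : t + 2 * val b ≡ suc (2 * (val a + 2 ^ n))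
  e′ = trans e (cong suc (sym (*-distribˡ-+ 2 (val a) (2 ^ n))))
gcd-lowBit {suc n} (false ∷ a) (true ∷ b) t e with even-summand {suc t} {val b} {val a + 2 ^ n} e′
  where
  e′ : suc t + 2 * val b ≡ 2 * (val a + 2 ^ n)
  e′ = trans (sym (+-suc t _)) (trans e (sym (*-distribˡ-+ 2 (val a) (2 ^ n))))
... | u , suc-t-even , _ = odd-gcd-2pow {t} (pred-even-odd {t} {u} suc-t-even) (suc n)

gcd-mod : ∀ t m .{{_ : NonZero m}} → gcd (t % m) m ≡ gcd t m
gcd-mod t m = ∣-antisym
  (gcd-greatest (∣n∣m%n⇒∣m (gcd[m,n]∣n (t % m) m) (gcd[m,n]∣m (t % m) m)) (gcd[m,n]∣n (t % m) m))
  (gcd-greatest (%-presˡ-∣ (gcd[m,n]∣m t m) (gcd[m,n]∣n t m)) (gcd[m,n]∣n t m))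

subMod-representative : ∀ m (a b : Fin m) →
  Σ ℕ λ t → t + toℕ b ≡ toℕ a + m × gcd (subMod a b) m ≡ gcd t m
subMod-representative (suc m) a b = toℕ a + (suc m ∸ toℕ b) ,
  trans (+-assoc (toℕ a) _ _) (cong (toℕ a +_) (m∸n+n≡m (<⇒≤ (toℕ<n b)))) ,
  gcd-mod (toℕ a + (suc m ∸ toℕ b)) (suc m)

gcd-subMod-2pow : ∀ n (a b : Fin (2 ^ n)) →
  gcd (subMod a b) (2 ^ n) ≡ lowBit (zipWith _xor_ (toBits n a) (toBits n b))
gcd-subMod-2pow n a b with subMod-representative (2 ^ n) a b
... | t , e , g = trans g (gcd-lowBit (toBits n a) (toBits n b) t
  (trans (cong (t +_) (val-toBits n b)) (trans e (cong (_+ 2 ^ n) (sym (val-toBits n a))))))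

record BinaryCode (ms : List ℕ) : Set where
  field
    N        : ℕ
    encoding : Elem ms ↔ Vec Bool N
    profile  : Vec Bool N → List ℕ
    gcdTuple-via-xor : ∀ a b → gcdTupleDiff ms a b ≡
      profile (zipWith _xor_ (Inverse.to encoding a) (Inverse.to encoding b))

take-++ : ∀ {A : Set} {m n} (a : Vec A m) (b : Vec A n) → take m (a ++ᵛ b) ≡ a
take-++ {m = m} a b = proj₁ (++-injective (take m (a ++ᵛ b)) a (take++drop≡id m (a ++ᵛ b)))

drop-++ : ∀ {A : Set} {m n} (a : Vec A m) (b : Vec A n) → dropᵛ m (a ++ᵛ b) ≡ b
drop-++ {m = m} a b = proj₂ (++-injective (take m (a ++ᵛ b)) a (take++drop≡id m (a ++ᵛ b)))

vec-++ : ∀ {A : Set} m {n} → (Vec A m × Vec A n) ↔ Vec A (m + n)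
vec-++ m = mk↔ₛ′ (λ (a , b) → a ++ᵛ b) (λ v → take m v , dropᵛ m v)
  (take++drop≡id m) (λ (a , b) → ×-≡,≡→≡ (take-++ a b , drop-++ a b))

binaryCode-2pow : ∀ ns → BinaryCode (map (2 ^_) ns)
binaryCode-2pow [] = record
  { N = 0 ; encoding = mk↔ₛ′ (λ _ → []) (λ _ → tt) (λ { [] → refl }) (λ _ → refl)
  ; profile = λ _ → [] ; gcdTuple-via-xor = λ _ _ → refl }
binaryCode-2pow (n ∷ ns) = record
  { N = n + N
  ; encoding = encoding′
  ; profile = profile′
  ; gcdTuple-via-xor = via-xor
  }
  where
  open BinaryCode (binaryCode-2pow ns)
  encoding′ : Elem (map (2 ^_) (n ∷ ns)) ↔ Vec Bool (n + N)
  encoding′ = ↔-trans (binary n ×-↔ encoding) (vec-++ n)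
  profile′ : Vec Bool (n + N) → List ℕ
  profile′ c = lowBit (take n c) ∷ profile (dropᵛ n c)
  via-xor : ∀ u v → gcdTupleDiff (map (2 ^_) (n ∷ ns)) u v ≡
    profile′ (zipWith _xor_ (Inverse.to encoding′ u) (Inverse.to encoding′ v))
  via-xor (a , as) (b , bs)
    rewrite zipWith-++ _xor_ (toBits n a) (Inverse.to encoding as) (toBits n b) (Inverse.to encoding bs)
    = cong₂ _∷_
        (trans (gcd-subMod-2pow n a b) (cong lowBit (sym (take-++ head tail))))
        (trans (gcdTuple-via-xor as bs) (cong profile (sym (drop-++ head tail))))
    where
    head : Vec Bool n
    head = zipWith _xor_ (toBits n a) (toBits n b)
    tail : Vec Bool N
    tail = zipWith _xor_ (Inverse.to encoding as) (Inverse.to encoding bs)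

splitElem : ∀ xs {ys} → Elem (xs ++ ys) → Elem xs × Elem ys
splitElem []       u       = tt , u
splitElem (x ∷ xs) (a , u) = (a , proj₁ (splitElem xs u)) , proj₂ (splitElem xs u)

joinElem : ∀ xs {ys} → Elem xs × Elem ys → Elem (xs ++ ys)
joinElem []       (_ , v)       = v
joinElem (x ∷ xs) ((a , u) , v) = a , joinElem xs (u , v)

Elem-++ : ∀ xs {ys} → Elem (xs ++ ys) ↔ (Elem xs × Elem ys)
Elem-++ xs = mk↔ₛ′ (splitElem xs) (joinElem xs) (split-join xs) (join-split xs)
  where
  split-join : ∀ xs {ys} (p : Elem xs × Elem ys) → splitElem xs (joinElem xs p) ≡ p
  split-join []       (tt , v)      = refl
  split-join (x ∷ xs) ((a , u) , v) rewrite split-join xs (u , v) = refl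
  join-split : ∀ xs {ys} (w : Elem (xs ++ ys)) → joinElem xs (splitElem xs w) ≡ w
  join-split []       w       = refl
  join-split (x ∷ xs) (a , w) = cong (a ,_) (join-split xs w)

gcdTupleDiff-++ : ∀ xs {ys} (u v : Elem (xs ++ ys)) →
  gcdTupleDiff (xs ++ ys) u v ≡
  gcdTupleDiff xs (proj₁ (splitElem xs u)) (proj₁ (splitElem xs v)) ++
  gcdTupleDiff ys (proj₂ (splitElem xs u)) (proj₂ (splitElem xs v))
gcdTupleDiff-++ []       u       v       = refl
gcdTupleDiff-++ (x ∷ xs) (a , u) (b , v) = cong (_ ∷_) (gcdTupleDiff-++ xs u v)

drop-gcdTupleDiff : ∀ xs (a b : Elem xs) (ys : List ℕ) → drop (length xs) (gcdTupleDiff xs a b ++ ys) ≡ ys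
drop-gcdTupleDiff []       a       b       ys = refl
drop-gcdTupleDiff (x ∷ xs) (_ , a) (_ , b) ys = drop-gcdTupleDiff xs a b ys

cayley-factor : ∀ {ms₁} (code : BinaryCode ms₁) ms₂ (D : List (List ℕ)) (dT : List ℕ)
  (C : List (Vec Bool (BinaryCode.N code))) →
  (∀ d → d ∈ D → drop (length ms₁) d ≡ dT) →
  (∀ c → c ∈ C ⇔ (BinaryCode.profile code c ++ dT) ∈ D) →
  GraphIso (CayGcdAdj (ms₁ ++ ms₂) D) (KronAdj (CubeAdj C) (CayGcdAdj ms₂ (dT ∷ [])))
cayley-factor {ms₁} code ms₂ D dT C suffix C-spec =
  ↔-trans (Elem-++ ms₁) (encoding ×-↔ ↔-refl) , λ u v → adjacency (splitElem ms₁ u) (splitElem ms₁ v)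
    (gcdTupleDiff-++ ms₁ u v)
  where
  open BinaryCode code
  adjacency : ∀ ((a , x) (b , y) : Elem ms₁ × Elem ms₂) {g} →
    g ≡ gcdTupleDiff ms₁ a b ++ gcdTupleDiff ms₂ x y →
    g ∈ D ⇔ (zipWith _xor_ (Inverse.to encoding a) (Inverse.to encoding b) ∈ C ×
             gcdTupleDiff ms₂ x y ∈ dT ∷ [])
  adjacency (a , x) (b , y) {g} refl = mk⇔ forward backward
    where
    c : Vec Bool N
    c = zipWith _xor_ (Inverse.to encoding a) (Inverse.to encoding b)
    g≡ : ∀ t → gcdTupleDiff ms₁ a b ++ t ≡ profile c ++ t
    g≡ t = cong (_++ t) (gcdTuple-via-xor a b)
    forward : g ∈ D → c ∈ C × gcdTupleDiff ms₂ x y ∈ dT ∷ []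
    forward g∈D = Equivalence.from (C-spec c) (subst (λ t → (profile c ++ t) ∈ D) tail≡dT
                    (subst (_∈ D) (g≡ _) g∈D)) , here tail≡dT
      where
      tail≡dT : gcdTupleDiff ms₂ x y ≡ dT
      tail≡dT = trans (sym (drop-gcdTupleDiff ms₁ a b _)) (suffix g g∈D)
    backward : c ∈ C × gcdTupleDiff ms₂ x y ∈ dT ∷ [] → g ∈ D
    backward (c∈C , here refl) = subst (_∈ D) (sym (g≡ _)) (Equivalence.to (C-spec c) c∈C)

enumerate : ∀ N {P : Vec Bool N → Set} → Decidable P → Σ (List (Vec Bool N)) λ C → ∀ c → c ∈ C ⇔ P c
enumerate N P? = filter P? allVecs , λ c → mk⇔ (proj₂ ∘ ∈-filter⁻ P? {xs = allVecs}) (∈-filter⁺ P? (complete c))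
  where
  allVecs : List (Vec Bool N)
  allVecs = map (toBits N) (allFin (2 ^ N))
  complete : ∀ c → c ∈ allVecs
  complete c = subst (_∈ allVecs) (toBits-fromBits c) (∈-map⁺ (toBits N) (∈-allFin (fromBits c)))

-- (8) Lemma 4.6.

lemma4p6 : (r s : ℕ) (ns : Vec ℕ r) (ps es : Vec ℕ s)
    → VAll (λ n → 1 ≤ n) ns
    → VAll Prime ps → VAll (λ p → 2 < p) ps
    → VAll (λ e → 1 ≤ e) es
    → (dT : List ℕ) → IsDivisorTuple dT (oddModuli ps es)
    → (D : List (List ℕ))
    → (∀ d → d ∈ D → IsDivisorTuple d (map (2 ^_) (toList ns) ++ oddModuli ps es))
    → (map (2 ^_) (toList ns) ++ oddModuli ps es) ∉ D
    → (∀ d → d ∈ D → drop r d ≡ dT)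
    → Σ ℕ λ N → Σ (List (Vec Bool N)) λ C →
        GraphIso (CayGcdAdj (map (2 ^_) (toList ns) ++ oddModuli ps es) D)
                 (KronAdj (CubeAdj C) (CayGcdAdj (oddModuli ps es) (dT Data.List.∷ Data.List.[])))
lemma4p6 r s ns ps es _ _ _ _ dT _ D _ _ suffix =
  N , proj₁ C , cayley-factor code (oddModuli ps es) D dT (proj₁ C) suffix′ (proj₂ C)
  where
  code : BinaryCode (map (2 ^_) (toList ns))
  code = binaryCode-2pow (toList ns)
  open BinaryCode code using (N; profile)
  open DecMembership (≡-dec _≟_) using (_∈?_)
  C : Σ (List (Vec Bool N)) λ C → ∀ c → c ∈ C ⇔ (profile c ++ dT) ∈ D
  C = enumerate N (λ c → (profile c ++ dT) ∈? D)
  suffix′ : ∀ d → d ∈ D → drop (length (map (2 ^_) (toList ns))) d ≡ dT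
  suffix′ d d∈D = trans (cong (λ k → drop k d) (trans (length-map _ (toList ns)) (length-toList ns)))
                        (suffix d d∈D)
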